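{- In any multi-flock chicken graph (with at least one chicken), either there is a 2-Duke, or there are (at least) three distinct 3-Dukes.
   Context: A multi-flock chicken graph is a finite orientation of a complete multipartite graph; vertices are called chickens and partite sets are called flocks. "$c$ pecks $d$" means the edge between $c$ and $d$ is oriented from $c$ to $d$. A peck chain of length $m$ is a directed path with $m$ edges. A chicken $d$ is an $m$-Duke if every chicken not in the flock of $d$ can be reached from $d$ by a peck chain of length at most $m$. -}

module Defs where

open import Data.Nat using (ℕ; zero; suc; _≤_)
open import Data.Fin using (Fin)
open import Data.Bool using (Bool; true; false)
open import Data.Product using (_×_; Σ)
open import Data.Sum using (_⊎_)
open import Relation.Nullary using (¬_)
open import Relation.Binary.PropositionalEquality using (_≡_; _≢_)

-- A multi-flock chicken graph on chickens Fin n: each chicken has a flock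
-- (an arbitrary label in ℕ), and a Boolean "pecks" relation which is an
-- orientation of the complete multipartite graph determined by the flocks.
record ChickenGraph (n : ℕ) : Set where
  field
    flock : Fin n → ℕ
    pecks : Fin n → Fin n → Bool
    sameFlock-noPeck : ∀ c d → flock c ≡ flock d → pecks c d ≡ false
    diffFlock-peck : ∀ c d → flock c ≢ flock d →
      (pecks c d ≡ true × pecks d c ≡ false) ⊎ (pecks c d ≡ false × pecks d c ≡ true)

open ChickenGraph public

data PeckChain {n : ℕ} (G : ChickenGraph n) : ℕ → Fin n → Fin n → Set where
  here : ∀ {c} → PeckChain G zero c c
  step : ∀ {m c d e} → pecks G c d ≡ true → PeckChain G m d e → PeckChain G (suc m) c e

ReachWithin : {n : ℕ} → ChickenGraph n → ℕ → Fin n → Fin n → Set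
ReachWithin G m d c = Σ ℕ (λ l → l ≤ m × PeckChain G l d c)

IsDuke : {n : ℕ} → ChickenGraph n → ℕ → Fin n → Set
IsDuke G m d = ∀ c → flock G c ≢ flock G d → ReachWithin G m d c

-- Write N(x) for the set of chickens x reaches by a peck chain of length at most 2
-- (x included). If a chicken c of another flock is not reached by f within 3 pecks,
-- then c pecks f and everything f reaches within 2 pecks, c reaches too: so N(f) ⊂ N(c).
-- Hence a chicken d with N(d) inclusion-maximal is a 3-Duke. If d is no 2-Duke, the
-- chickens of other flocks escaping N(d) all peck d; one of them, e, with N(e) maximal
-- among them is again a 3-Duke, the chickens that could defeat it being excluded by the
-- maximality of d. Repeating the step once more from e yields a third 3-Duke f.
module Submission where

open import Defs
open import Data.Nat using (ℕ; suc; z≤n; s≤s)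
import Data.Nat as ℕ
open import Data.Nat.Properties using (≤-refl; m≤n⇒m≤1+n)
open import Data.Fin using (Fin; zero; _≟_)
open import Data.Fin.Properties using (any?)
open import Data.Fin.Subset using (Subset; _∈_; _⊂_)
open import Data.Fin.Subset.Properties using (_⊂?_)
open import Data.Fin.Subset.Induction using (⊃-wellFounded)
open import Data.Vec using (tabulate)
open import Data.Vec.Properties using (lookup⇒[]=; []=⇒lookup; lookup∘tabulate)
open import Data.Bool using (true)
import Data.Bool.Properties as Bool
open import Data.Product using (Σ; _×_; _,_; ∃; proj₂)
open import Data.Sum using (_⊎_; inj₁; inj₂; [_,_]′)
open import Data.Empty using (⊥; ⊥-elim)
open import Data.Unit using (⊤; tt)
open import Function using (_∘_)
open import Induction.WellFounded using (Acc; acc)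
open import Relation.Nullary using (¬_; Dec; yes; no; does; proof)
open import Relation.Nullary.Decidable using (dec-true; map′; _×-dec_; _⊎-dec_; ¬?)
open import Relation.Nullary.Reflects using (Reflects; invert)
open import Relation.Unary using (Pred; Decidable)
open import Relation.Binary.PropositionalEquality
  using (_≡_; _≢_; refl; sym; trans; subst; ≢-sym)

module _ {n p} {P : Pred (Fin n) p} (P? : Decidable P) where

  subset : Subset n
  subset = tabulate (does ∘ P?)

  ∈-subset⁺ : ∀ {x} → P x → x ∈ subset
  ∈-subset⁺ {x} px = lookup⇒[]= x subset (trans (lookup∘tabulate _ x) (dec-true (P? x) px))

  ∈-subset⁻ : ∀ {x} → x ∈ subset → P x
  ∈-subset⁻ {x} x∈ =
    invert (subst (Reflects (P x)) (trans (sym (lookup∘tabulate _ x)) ([]=⇒lookup x∈)) (proof (P? x)))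

module _ {m n p} {P : Pred (Fin m) p} (P? : Decidable P) (N : Fin m → Subset n) where

  ⊂-maximal : ∀ {x} → P x → ∃ λ y → P y × ∀ z → P z → ¬ N y ⊂ N z
  ⊂-maximal {x} px = climb x (⊃-wellFounded (N x)) px
    where
    climb : ∀ x → Acc _ (N x) → P x → ∃ λ y → P y × ∀ z → P z → ¬ N y ⊂ N z
    climb x (acc rs) px with any? (λ z → P? z ×-dec N x ⊂? N z)
    ... | no ¬larger = x , px , λ z pz x⊂z → ¬larger (z , pz , x⊂z)
    ... | yes (z , pz , x⊂z) = climb z (rs x⊂z) pz

module Dukes {n} (G : ChickenGraph n) where

  infix 4 _↦_ _⇝₂_ _⇝₃_ _⊏_
  infixr 5 _◅_
  infix 5 _▻_

  _↦_ : Fin n → Fin n → Set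
  c ↦ d = pecks G c d ≡ true

  _↦?_ : ∀ c d → Dec (c ↦ d)
  c ↦? d = pecks G c d Bool.≟ true

  ↦⇒flock≢ : ∀ {c d} → c ↦ d → flock G c ≢ flock G d
  ↦⇒flock≢ {c} {d} c↦d c≈d with trans (sym c↦d) (sameFlock-noPeck G c d c≈d)
  ... | ()

  ¬↤⇒↦ : ∀ {c d} → flock G c ≢ flock G d → ¬ d ↦ c → c ↦ d
  ¬↤⇒↦ {c} {d} c≉d ¬d↦c with diffFlock-peck G c d c≉d
  ... | inj₁ (c↦d , _) = c↦d
  ... | inj₂ (_ , d↦c) = ⊥-elim (¬d↦c d↦c)

  data _⇝₂_ (x : Fin n) : Fin n → Set where
    stay : x ⇝₂ x
    one  : ∀ {y} → x ↦ y → x ⇝₂ y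
    two  : ∀ {y z} → x ↦ z → z ↦ y → x ⇝₂ y

  data _⇝₃_ (x : Fin n) : Fin n → Set where
    within₂ : ∀ {y} → x ⇝₂ y → x ⇝₃ y
    _◅_     : ∀ {y z} → x ↦ z → z ⇝₂ y → x ⇝₃ y

  _⇝₂?_ : ∀ x y → Dec (x ⇝₂ y)
  x ⇝₂? y = map′ from to (x ≟ y ⊎-dec x ↦? y ⊎-dec any? (λ z → x ↦? z ×-dec z ↦? y))
    where
    from : x ≡ y ⊎ x ↦ y ⊎ ∃ (λ z → x ↦ z × z ↦ y) → x ⇝₂ y
    from (inj₁ refl)                = stay
    from (inj₂ (inj₁ x↦y))          = one x↦y
    from (inj₂ (inj₂ (_ , p , q)))  = two p q
    to : x ⇝₂ y → x ≡ y ⊎ x ↦ y ⊎ ∃ (λ z → x ↦ z × z ↦ y)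
    to stay      = inj₁ refl
    to (one x↦y) = inj₂ (inj₁ x↦y)
    to (two p q) = inj₂ (inj₂ (_ , p , q))

  _⇝₃?_ : ∀ x y → Dec (x ⇝₃ y)
  x ⇝₃? y = map′ [ within₂ , (λ (_ , p , r) → p ◅ r) ]′ to
    (x ⇝₂? y ⊎-dec any? (λ z → x ↦? z ×-dec z ⇝₂? y))
    where
    to : x ⇝₃ y → x ⇝₂ y ⊎ ∃ (λ z → x ↦ z × z ⇝₂ y)
    to (within₂ r) = inj₁ r
    to (p ◅ r)     = inj₂ (_ , p , r)

  ⇝₂⇒reachWithin₂ : ∀ {x y} → x ⇝₂ y → ReachWithin G 2 x y
  ⇝₂⇒reachWithin₂ stay      = 0 , z≤n , here
  ⇝₂⇒reachWithin₂ (one p)   = 1 , s≤s z≤n , step p here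
  ⇝₂⇒reachWithin₂ (two p q) = 2 , ≤-refl , step p (step q here)

  ⇝₃⇒reachWithin₃ : ∀ {x y} → x ⇝₃ y → ReachWithin G 3 x y
  ⇝₃⇒reachWithin₃ (within₂ r) with ⇝₂⇒reachWithin₂ r
  ... | l , l≤2 , chain = l , m≤n⇒m≤1+n l≤2 , chain
  ⇝₃⇒reachWithin₃ (p ◅ r) with ⇝₂⇒reachWithin₂ r
  ... | l , l≤2 , chain = suc l , s≤s l≤2 , step p chain

  _▻_ : ∀ {x y z} → x ⇝₂ y → y ↦ z → x ⇝₃ z
  stay    ▻ q = within₂ (one q)
  one p   ▻ q = within₂ (two p q)
  two p r ▻ q = p ◅ two r q

  reach₂ : Fin n → Subset n
  reach₂ x = subset (x ⇝₂?_)

  _⊏_ : Fin n → Fin n → Set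
  x ⊏ y = reach₂ x ⊂ reach₂ y

  ⊏-intro : ∀ {x y} → (∀ {z} → x ⇝₂ z → y ⇝₂ z) → ¬ x ⇝₂ y → x ⊏ y
  ⊏-intro {x} {y} x⊆y ¬x⇝y =
    (∈-subset⁺ (y ⇝₂?_) ∘ x⊆y ∘ ∈-subset⁻ (x ⇝₂?_)) , y , ∈-subset⁺ (y ⇝₂?_) stay ,
    ¬x⇝y ∘ ∈-subset⁻ (x ⇝₂?_)

  unreachable₃⇒⊆ : ∀ {c f} → flock G c ≢ flock G f → ¬ f ⇝₃ c → ∀ {y} → f ⇝₂ y → c ⇝₂ y
  unreachable₃⇒⊆ {c} {f} c≉f ¬f⇝c = dominate
    where
    beats : ∀ {y} → f ⇝₂ y → flock G y ≢ flock G c → c ↦ y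
    beats f⇝y y≉c = ¬↤⇒↦ (≢-sym y≉c) (¬f⇝c ∘ (f⇝y ▻_))
    dominate : ∀ {y} → f ⇝₂ y → c ⇝₂ y
    dominate {y} f⇝y with flock G y ℕ.≟ flock G c
    dominate f⇝y             | no y≉c  = one (beats f⇝y y≉c)
    dominate stay            | yes f≈c = ⊥-elim (c≉f (sym f≈c))
    dominate (one f↦y)       | yes _   = two (beats stay (≢-sym c≉f)) f↦y
    dominate (two f↦x x↦y)   | yes y≈c =
      two (beats (one f↦x) (λ x≈c → ↦⇒flock≢ x↦y (trans x≈c (sym y≈c)))) x↦y

  unreachable₃⇒⊏ : ∀ {c f} → flock G c ≢ flock G f → ¬ f ⇝₃ c → f ⊏ c
  unreachable₃⇒⊏ c≉f ¬f⇝c = ⊏-intro (unreachable₃⇒⊆ c≉f ¬f⇝c) (¬f⇝c ∘ within₂)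

  unreachable₃⇒prey⊏ : ∀ {c e f} → f ↦ e → flock G c ≡ flock G e → ¬ f ⇝₃ c → e ⊏ c
  unreachable₃⇒prey⊏ {c} {e} {f} f↦e c≈e ¬f⇝c = ⊏-intro dominate (¬f⇝c ∘ (f↦e ◅_))
    where
    c≉f : flock G c ≢ flock G f
    c≉f c≈f = ↦⇒flock≢ f↦e (trans (sym c≈f) c≈e)
    dominate : ∀ {y} → e ⇝₂ y → c ⇝₂ y
    dominate stay          = unreachable₃⇒⊆ c≉f ¬f⇝c (one f↦e)
    dominate (one e↦y)     = unreachable₃⇒⊆ c≉f ¬f⇝c (two f↦e e↦y)
    dominate (two e↦x x↦y) =
      two (¬↤⇒↦ (λ c≈x → ↦⇒flock≢ e↦x (trans (sym c≈e) c≈x)) (¬f⇝c ∘ (f↦e ◅_) ∘ two e↦x)) x↦y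

  Maximal : Pred (Fin n) _ → Fin n → Set
  Maximal S x = S x × ∀ y → S y → ¬ x ⊏ y

  maximal-exists : ∀ {S : Pred (Fin n) _} → Decidable S → ∀ {x} → S x → ∃ (Maximal S)
  maximal-exists S? = ⊂-maximal S? reach₂

  duke₃-intro : ∀ {x} → (∀ c → flock G c ≢ flock G x → ¬ x ⇝₃ c → ⊥) → IsDuke G 3 x
  duke₃-intro {x} escape c c≉x with x ⇝₃? c
  ... | yes x⇝c = ⇝₃⇒reachWithin₃ x⇝c
  ... | no ¬x⇝c = ⊥-elim (escape c c≉x ¬x⇝c)

  Unreached₂ : Fin n → Pred (Fin n) _
  Unreached₂ d y = flock G y ≢ flock G d × ¬ d ⇝₂ y

  unreached₂? : ∀ d → Decidable (Unreached₂ d)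
  unreached₂? d y = ¬? (flock G y ℕ.≟ flock G d) ×-dec ¬? (d ⇝₂? y)

  unreached₂⇒↦ : ∀ {d y} → Unreached₂ d y → y ↦ d
  unreached₂⇒↦ (y≉d , ¬d⇝y) = ¬↤⇒↦ y≉d (¬d⇝y ∘ one)

  unreached₂⇒≢ : ∀ {d y} → Unreached₂ d y → d ≢ y
  unreached₂⇒≢ (_ , ¬d⇝y) refl = ¬d⇝y stay

  duke₂⊎unreached₂ : ∀ d → IsDuke G 2 d ⊎ ∃ (Unreached₂ d)
  duke₂⊎unreached₂ d with any? (unreached₂? d)
  ... | yes unreached = inj₂ unreached
  ... | no ¬unreached = inj₁ reach
    where
    reach : IsDuke G 2 d
    reach c c≉d with d ⇝₂? c
    ... | yes d⇝c = ⇝₂⇒reachWithin₂ d⇝c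
    ... | no ¬d⇝c = ⊥-elim (¬unreached (c , c≉d , ¬d⇝c))

  maximal⇒duke₃ : ∀ {d} → Maximal (λ _ → ⊤) d → IsDuke G 3 d
  maximal⇒duke₃ (_ , d-max) = duke₃-intro λ c c≉d ¬d⇝c → d-max c tt (unreachable₃⇒⊏ c≉d ¬d⇝c)

  -- The flock of u is the only place where chickens defeating v could hide; the
  -- hypothesis rules them out.
  maximal-unreached₂⇒duke₃ : ∀ {u v} → Maximal (Unreached₂ u) v →
    (∀ c → flock G c ≡ flock G u → ¬ v ⇝₃ c → ¬ u ⊏ c) → IsDuke G 3 v
  maximal-unreached₂⇒duke₃ {u} {v} (uv , v-max) u-safe = duke₃-intro escape
    where
    escape : ∀ c → flock G c ≢ flock G v → ¬ v ⇝₃ c → ⊥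
    escape c c≉v ¬v⇝c with flock G c ℕ.≟ flock G u
    ... | no c≉u  = v-max c (c≉u , ¬v⇝c ∘ (unreached₂⇒↦ uv ◅_)) (unreachable₃⇒⊏ c≉v ¬v⇝c)
    ... | yes c≈u = u-safe c c≈u ¬v⇝c (unreachable₃⇒prey⊏ (unreached₂⇒↦ uv) c≈u ¬v⇝c)

  unreachable₃-flockmate⇒unreached₂ : ∀ {c d e f} → Unreached₂ d e → f ↦ e →
    flock G c ≡ flock G e → ¬ f ⇝₃ c → Unreached₂ d c
  unreachable₃-flockmate⇒unreached₂ {c} {d} {e} {f} de@(e≉d , ¬d⇝e) f↦e c≈e ¬f⇝c =
    (λ c≈d → e≉d (trans (sym c≈e) c≈d)) , ¬d⇝c
    where
    ¬d⇝c : ¬ d ⇝₂ c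
    ¬d⇝c stay          = e≉d (sym c≈e)
    ¬d⇝c (one d↦c)     = ¬f⇝c (f↦e ◅ two (unreached₂⇒↦ de) d↦c)
    ¬d⇝c (two d↦x x↦c) = ¬f⇝c (f↦e ◅ two e↦x x↦c)
      where
      e↦x : e ↦ _
      e↦x = ¬↤⇒↦ (λ e≈x → ↦⇒flock≢ x↦c (trans (sym e≈x) (sym c≈e))) (¬d⇝e ∘ two d↦x)

  duke₂⊎three-duke₃ : Fin n →
    Σ (Fin n) (λ d → IsDuke G 2 d)
    ⊎ Σ (Fin n) (λ a → Σ (Fin n) (λ b → Σ (Fin n) (λ c →
        a ≢ b × a ≢ c × b ≢ c × IsDuke G 3 a × IsDuke G 3 b × IsDuke G 3 c)))
  duke₂⊎three-duke₃ x with maximal-exists {S = λ _ → ⊤} (λ _ → yes tt) {x} tt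
  ... | d , d-max with duke₂⊎unreached₂ d
  ... | inj₁ d-duke₂ = inj₁ (d , d-duke₂)
  ... | inj₂ (_ , de₀) with maximal-exists (unreached₂? d) de₀
  ... | e , e-max@(de , _) with duke₂⊎unreached₂ e
  ... | inj₁ e-duke₂ = inj₁ (e , e-duke₂)
  ... | inj₂ (_ , ef₀) with maximal-exists (unreached₂? e) ef₀
  ... | f , f-max@(ef , _) =
    inj₂ (d , e , f , unreached₂⇒≢ de , d≢f , unreached₂⇒≢ ef ,
          maximal⇒duke₃ d-max ,
          maximal-unreached₂⇒duke₃ e-max (λ c _ _ → proj₂ d-max c tt) ,
          maximal-unreached₂⇒duke₃ f-max (λ c c≈e ¬f⇝c → proj₂ e-max c
            (unreachable₃-flockmate⇒unreached₂ de (unreached₂⇒↦ ef) c≈e ¬f⇝c)))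
    where
    d≢f : d ≢ f
    d≢f refl = proj₂ ef (one (unreached₂⇒↦ de))

corollary2 : (n : ℕ) (G : ChickenGraph (suc n)) →
    Σ (Fin (suc n)) (λ d → IsDuke G 2 d)
    ⊎ Σ (Fin (suc n)) (λ a → Σ (Fin (suc n)) (λ b → Σ (Fin (suc n)) (λ c →
    a ≢ b × a ≢ c × b ≢ c × IsDuke G 3 a × IsDuke G 3 b × IsDuke G 3 c)))
corollary2 n G = Dukes.duke₂⊎three-duke₃ G zero
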